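{- Let $n$ be a positive integer and let $g=2-\sqrt{3}$. In the prism graph $Y_n$ with unit edge resistances, for every $i\in\{1,\dots,n\}$ the effective resistances satisfy $$r(p_1,p_i)=\frac{1+g^n-g^{\,n-i+1}-g^{\,i-1}}{2\sqrt{3}\,(1-g^n)}+\frac{(n-i+1)(i-1)}{2n},$$ $$r(p_1,q_i)=\frac{1+g^n+g^{\,n-i+1}+g^{\,i-1}}{2\sqrt{3}\,(1-g^n)}+\frac{(n-i+1)(i-1)}{2n}.$$ Moreover, for all $j,i\in\{1,\dots,n\}$, $r(p_j,p_k)=r(q_j,q_k)=r(p_1,p_i)$ and $r(p_j,q_k)=r(q_j,p_k)=r(p_1,q_i)$, where $k\in\{1,\dots,n\}$ with $k\equiv j+i-1 \pmod n$.
   Context: For $n\ge 3$, the prism graph $Y_n$ is the graph with $2n$ vertices $p_1,\dots,p_n,q_1,\dots,q_n$ and $3n$ edges: the cycle edges $p_jp_{j+1}$ and $q_jq_{j+1}$ (indices mod $n$) and the rungs $p_jq_j$; equivalently $Y_n=P_2\,\Box\, C_n$. For $n=1,2$ the same Cartesian-product description is used with $C_2$ being two vertices joined by two parallel edges and $C_1$ being one vertex with a loop. Every edge has resistance $1$, and $r(x,y)$ denotes the effective resistance between vertices $x,y$ of $Y_n$ viewed as an electrical network. -}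

module Defs where

open import Data.Nat as ℕ using (ℕ; zero; suc; _∸_)
open import Data.Nat.DivMod using (_mod_)
open import Data.Fin as Fin using (Fin; toℕ)
open import Data.Fin.Properties using () renaming (_≟_ to _≟F_)
open import Data.Rational as ℚ using (ℚ; 0ℚ; 1ℚ)
open import Data.Rational.Properties using () renaming (_≟_ to _≟ℚ_)
open import Data.Integer using (+_)
open import Data.Product using (_×_; _,_; Σ; Σ-syntax)
open import Relation.Nullary using (yes; no; Dec)
open import Relation.Binary.PropositionalEquality using (_≡_; _≢_; refl; cong)

-- The field ℚ(√3): the pair (a , b) represents a + b√3.

three two : ℚ
three = (+ 3) ℚ./ 1
two = (+ 2) ℚ./ 1

record K : Set where
  constructor _⊕_√3
  field
    re : ℚ
    im : ℚ
open K public

ι : ℚ → K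
ι a = a ⊕ 0ℚ √3

0K 1K √3 : K
0K = ι 0ℚ
1K = ι 1ℚ
√3 = 0ℚ ⊕ 1ℚ √3

infixl 6 _+K_ _-K_
infixl 7 _*K_ _/K_
infixr 8 _^K_

_+K_ : K → K → K
(a ⊕ b √3) +K (c ⊕ d √3) = (a ℚ.+ c) ⊕ (b ℚ.+ d) √3

-K_ : K → K
-K (a ⊕ b √3) = (ℚ.- a) ⊕ (ℚ.- b) √3

_-K_ : K → K → K
x -K y = x +K (-K y)

_*K_ : K → K → K
(a ⊕ b √3) *K (c ⊕ d √3) =
  (a ℚ.* c ℚ.+ three ℚ.* b ℚ.* d) ⊕ (a ℚ.* d ℚ.+ b ℚ.* c) √3

_^K_ : K → ℕ → K
x ^K zero  = 1K
x ^K suc n = x *K (x ^K n)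

-- total inverse on ℚ (0⁻¹ = 0)
invℚ : ℚ → ℚ
invℚ q with q ≟ℚ 0ℚ
... | yes _  = 0ℚ
... | no q≢0 = ℚ.1/_ q {{ℚ.≢-nonZero q≢0}}

-- (a + b√3)⁻¹ = (a - b√3)/(a² - 3b²); the norm a² - 3b² vanishes only
-- at 0 since √3 is irrational; total with 0⁻¹ = 0.
invK : K → K
invK (a ⊕ b √3) = (a ℚ.* N⁻¹) ⊕ ((ℚ.- b) ℚ.* N⁻¹) √3
  where N⁻¹ = invℚ (a ℚ.* a ℚ.- three ℚ.* b ℚ.* b)

_/K_ : K → K → K
x /K y = x *K invK y

fromℕK : ℕ → K
fromℕK n = ι ((+ n) ℚ./ 1)

-- The prism graph Y_n with n = suc m, vertices p_j , q_j (0-based j).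

data Side : Set where
  P Q : Side

other : Side → Side
other P = Q
other Q = P

_≟S_ : (s t : Side) → Dec (s ≡ t)
P ≟S P = yes refl
P ≟S Q = no (λ ())
Q ≟S P = no (λ ())
Q ≟S Q = yes refl

Vertex : ℕ → Set
Vertex m = Side × Fin (suc m)

_≟V_ : ∀ {m} (x y : Vertex m) → Dec (x ≡ y)
(s , i) ≟V (t , j) with s ≟S t | i ≟F j
... | yes refl | yes refl = yes refl
... | no s≢t   | _        = no (λ { refl → s≢t refl })
... | yes _    | no i≢j   = no (λ { refl → i≢j refl })

nextF prevF : ∀ {m} → Fin (suc m) → Fin (suc m)
nextF {m} j = (suc (toℕ j)) mod (suc m)
prevF {m} j = (toℕ j ℕ.+ m) mod (suc m)

-- Each vertex (s,j) has the three edges to (s,j+1), (s,j-1), (other s,j);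
-- for n = 2 the two cycle edges are the two parallel edges of C_2, for
-- n = 1 they are the two ends of the loop of C_1 (contributing 0).
Laplacian : ∀ {m} → (Vertex m → K) → Vertex m → K
Laplacian v (s , j) =
    (v (s , j) -K v (s , nextF j))
  +K (v (s , j) -K v (s , prevF j))
  +K (v (s , j) -K v (other s , j))

δ : ∀ {m} → Vertex m → Vertex m → K
δ x w with x ≟V w
... | yes _ = 1K
... | no _  = 0K

IsPotential : ∀ {m} → Vertex m → Vertex m → (Vertex m → K) → Set
IsPotential x y v = ∀ w → Laplacian v w ≡ δ x w -K δ y w

IsEffRes : ∀ {m} → Vertex m → Vertex m → K → Set
IsEffRes x y r =
  Σ[ v ∈ (_ → K) ] IsPotential x y v
  × (∀ v → IsPotential x y v → v x -K v y ≡ r)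

-- The closed formulas (i' = i - 1 = toℕ i, n = suc m).

g : K
g = ι two -K √3

quadPart : ℕ → ℕ → K
quadPart n i' = fromℕK ((n ∸ i') ℕ.* i') /K fromℕK (2 ℕ.* n)

rPP : (m : ℕ) → Fin (suc m) → K
rPP m i = (1K +K g ^K n -K g ^K (n ∸ toℕ i) -K g ^K toℕ i)
            /K (fromℕK 2 *K √3 *K (1K -K g ^K n))
          +K quadPart n (toℕ i)
  where n = suc m

rPQ : (m : ℕ) → Fin (suc m) → K
rPQ m i = (1K +K g ^K n +K g ^K (n ∸ toℕ i) +K g ^K toℕ i)
            /K (fromℕK 2 *K √3 *K (1K -K g ^K n))
          +K quadPart n (toℕ i)
  where n = suc m

-- k ≡ j + i - 1 (mod n), in 0-based indices: k' = (j' + i') mod n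
shiftF : ∀ {m} → Fin (suc m) → Fin (suc m) → Fin (suc m)
shiftF {m} j i = (toℕ j ℕ.+ toℕ i) mod (suc m)

-- Fix a source vertex x = (s, j) of Y_n and write d for the cyclic offset of a vertex w
-- from j and σ = ±1 according to whether w lies on the side of x.  The kernel
--   Λ_x(w) = Q(d) − σ E(d),   Q(d) = (n − d) d / (2n),   E(d) = (g^d + g^(n−d)) / (2√3 (1 − g^n))
-- has Laplacian 1/n − 2 δ_x: along the cycle Q has second difference 1/n away from d = 0,
-- while E(d + 1) + E(d − 1) = 4 E(d) for 0 < d < n because g is a root of x² − 4x + 1, so
-- only the boundary terms at d = 0 survive.  Hence ½ (Λ_y − Λ_x) carries the unit current
-- from x to y, and any other such potential differs from it by a harmonic function, which is
-- constant by the maximum principle.  So r(x, y) = Λ_x(y) − Λ_x(x), which only depends on the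
-- offset of y from x and on the sides; this is the stated formula.

module Submission where

open import Defs
open import Data.Nat using (ℕ)
open import Data.Fin using (Fin; zero)
open import Data.Product using (_×_; _,_)

open import Algebra.Bundles using (CommutativeRing)
open import Data.Empty using (⊥-elim)
open import Data.Fin using (toℕ)
import Data.Fin.Properties as Fin
open import Data.Integer as ℤ using (1ℤ)
import Data.Integer.Properties as ℤ
import Data.Integer.Tactic.RingSolver as ℤ-Solver
open import Data.List using (List; _∷_; []; cartesianProduct; allFin)
open import Data.List.Membership.Propositional using (_∈_)
open import Data.List.Membership.Propositional.Properties using (∈-cartesianProduct⁺; ∈-allFin)
import Data.List.Extrema as Extrema
open import Data.List.Relation.Unary.Any using (here; there)
import Data.List.Relation.Unary.All as All
open import Data.Maybe using (Maybe; just; nothing)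
open import Data.Nat as ℕ using (zero; suc; _+_; _∸_; _%_; _<_; _≤_; NonZero)
import Data.Nat.Properties as ℕ
open import Data.Nat.DivMod
import Data.Nat.Tactic.RingSolver as ℕ-Solver
open import Data.Product using (proj₁; proj₂)
open import Data.Rational as ℚ using (ℚ; 0ℚ; 1ℚ)
import Data.Rational.Properties as ℚ
open import Data.Rational.Solver using (module +-*-Solver)
import Data.Rational.Unnormalised as ℚᵘ
import Data.Rational.Unnormalised.Properties as ℚᵘ
open import Data.Sum using (_⊎_; inj₁; inj₂)
open import Level using (0ℓ)
open import Relation.Binary.Bundles using (DecTotalOrder)
open import Relation.Binary.PropositionalEquality
open import Algebra.Structures {A = K} _≡_ using (IsCommutativeRing)
open import Relation.Nullary using (Dec; yes; no)
open import Tactic.RingSolver using (solve-∀)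
import Tactic.RingSolver.Core.AlmostCommutativeRing as ACR

⊕-≡ : ∀ {a b c d} → a ≡ c → b ≡ d → a ⊕ b √3 ≡ c ⊕ d √3
⊕-≡ refl refl = refl

_≟K_ : (x y : K) → Dec (x ≡ y)
(a ⊕ b √3) ≟K (c ⊕ d √3) with a ℚ.≟ c | b ℚ.≟ d
... | yes refl | yes refl = yes refl
... | no a≢c   | _        = no λ { refl → a≢c refl }
... | yes _    | no b≢d   = no λ { refl → b≢d refl }

module _ where
  open +-*-Solver

  +K-assoc : ∀ x y z → (x +K y) +K z ≡ x +K (y +K z)
  +K-assoc x y z = ⊕-≡ (ℚ.+-assoc (re x) (re y) (re z)) (ℚ.+-assoc (im x) (im y) (im z))

  +K-comm : ∀ x y → x +K y ≡ y +K x
  +K-comm x y = ⊕-≡ (ℚ.+-comm (re x) (re y)) (ℚ.+-comm (im x) (im y))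

  +K-identityˡ : ∀ x → 0K +K x ≡ x
  +K-identityˡ x = ⊕-≡ (ℚ.+-identityˡ (re x)) (ℚ.+-identityˡ (im x))

  +K-identityʳ : ∀ x → x +K 0K ≡ x
  +K-identityʳ x = ⊕-≡ (ℚ.+-identityʳ (re x)) (ℚ.+-identityʳ (im x))

  -K-inverseˡ : ∀ x → (-K x) +K x ≡ 0K
  -K-inverseˡ x = ⊕-≡ (ℚ.+-inverseˡ (re x)) (ℚ.+-inverseˡ (im x))

  -K-inverseʳ : ∀ x → x +K (-K x) ≡ 0K
  -K-inverseʳ x = ⊕-≡ (ℚ.+-inverseʳ (re x)) (ℚ.+-inverseʳ (im x))

  *K-assoc : ∀ x y z → (x *K y) *K z ≡ x *K (y *K z)
  *K-assoc (a ⊕ b √3) (c ⊕ d √3) (e ⊕ f √3) = ⊕-≡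
    (solve 7 (λ t a b c d e f → (a :* c :+ t :* b :* d) :* e :+ t :* (a :* d :+ b :* c) :* f
                             := a :* (c :* e :+ t :* d :* f) :+ t :* b :* (c :* f :+ d :* e))
           refl three a b c d e f)
    (solve 7 (λ t a b c d e f → (a :* c :+ t :* b :* d) :* f :+ (a :* d :+ b :* c) :* e
                             := a :* (c :* f :+ d :* e) :+ b :* (c :* e :+ t :* d :* f))
           refl three a b c d e f)

  *K-comm : ∀ x y → x *K y ≡ y *K x
  *K-comm (a ⊕ b √3) (c ⊕ d √3) = ⊕-≡
    (solve 5 (λ t a b c d → a :* c :+ t :* b :* d := c :* a :+ t :* d :* b) refl three a b c d)
    (solve 4 (λ a b c d → a :* d :+ b :* c := c :* b :+ d :* a) refl a b c d)

  *K-identityˡ : ∀ x → 1K *K x ≡ x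
  *K-identityˡ (a ⊕ b √3) = ⊕-≡
    (solve 3 (λ t a b → con 1ℚ :* a :+ t :* con 0ℚ :* b := a) refl three a b)
    (solve 2 (λ a b → con 1ℚ :* b :+ con 0ℚ :* a := b) refl a b)

  *K-distribˡ : ∀ x y z → x *K (y +K z) ≡ x *K y +K x *K z
  *K-distribˡ (a ⊕ b √3) (c ⊕ d √3) (e ⊕ f √3) = ⊕-≡
    (solve 7 (λ t a b c d e f → a :* (c :+ e) :+ t :* b :* (d :+ f)
                             := (a :* c :+ t :* b :* d) :+ (a :* e :+ t :* b :* f))
           refl three a b c d e f)
    (solve 6 (λ a b c d e f → a :* (d :+ f) :+ b :* (c :+ e)
                           := (a :* d :+ b :* c) :+ (a :* f :+ b :* e))
           refl a b c d e f)

K-isCommutativeRing : IsCommutativeRing _+K_ _*K_ (λ x → -K x) 0K 1K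
K-isCommutativeRing = record
  { isRing = record
    { +-isAbelianGroup = record
      { isGroup = record
        { isMonoid = record
          { isSemigroup = record
            { isMagma = record { isEquivalence = isEquivalence ; ∙-cong = cong₂ _+K_ }
            ; assoc = +K-assoc }
          ; identity = +K-identityˡ , +K-identityʳ }
        ; inverse = -K-inverseˡ , -K-inverseʳ
        ; ⁻¹-cong = cong (λ x → -K x) }
      ; comm = +K-comm }
    ; *-cong = cong₂ _*K_
    ; *-assoc = *K-assoc
    ; *-identity = *K-identityˡ , *K-identityʳ
    ; distrib = *K-distribˡ , *K-distribʳ }
  ; *-comm = *K-comm }
  where
  *K-identityʳ : ∀ x → x *K 1K ≡ x
  *K-identityʳ x = trans (*K-comm x 1K) (*K-identityˡ x)
  *K-distribʳ : ∀ x y z → (y +K z) *K x ≡ y *K x +K z *K x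
  *K-distribʳ x y z = trans (*K-comm (y +K z) x)
    (trans (*K-distribˡ x y z) (cong₂ _+K_ (*K-comm x y) (*K-comm x z)))

K-commutativeRing : CommutativeRing 0ℓ 0ℓ
K-commutativeRing = record { isCommutativeRing = K-isCommutativeRing }

-- The reflective solver needs to recognise zero coefficients to keep the
-- normal forms syntactically comparable.
K-almostCommutativeRing : ACR.AlmostCommutativeRing 0ℓ 0ℓ
K-almostCommutativeRing = ACR.fromCommutativeRing K-commutativeRing isZero
  where
  isZero : ∀ x → Maybe (0K ≡ x)
  isZero x with 0K ≟K x
  ... | yes 0≡x = just 0≡x
  ... | no _    = nothing

fromℕK-+ : ∀ a b → fromℕK (a ℕ.+ b) ≡ fromℕK a +K fromℕK b
fromℕK-+ a b = cong ι (ℚ.toℚᵘ-injective (begin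
  ℚ.toℚᵘ (ℤ.+ (a ℕ.+ b) ℚ./ 1)                   ≈⟨ ℚ.toℚᵘ-fromℚᵘ _ ⟩
  ℚᵘ.mkℚᵘ (ℤ.+ (a ℕ.+ b)) 0                      ≈⟨ ℚᵘ.*≡* numerators ⟩
  ℚᵘ.mkℚᵘ (ℤ.+ a) 0 ℚᵘ.+ ℚᵘ.mkℚᵘ (ℤ.+ b) 0       ≈⟨ ℚᵘ.+-cong (ℚ.toℚᵘ-fromℚᵘ (ℚᵘ.mkℚᵘ (ℤ.+ a) 0))
                                                              (ℚ.toℚᵘ-fromℚᵘ (ℚᵘ.mkℚᵘ (ℤ.+ b) 0)) ⟨
  ℚ.toℚᵘ (ℤ.+ a ℚ./ 1) ℚᵘ.+ ℚ.toℚᵘ (ℤ.+ b ℚ./ 1) ≈⟨ ℚ.toℚᵘ-homo-+ (ℤ.+ a ℚ./ 1) (ℤ.+ b ℚ./ 1) ⟨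
  ℚ.toℚᵘ (ℤ.+ a ℚ./ 1 ℚ.+ ℤ.+ b ℚ./ 1)           ∎))
  where
  open ℚᵘ.≃-Reasoning
  unit : ∀ x y → (x ℤ.+ y) ℤ.* 1ℤ ≡ (x ℤ.* 1ℤ ℤ.+ y ℤ.* 1ℤ) ℤ.* 1ℤ
  unit = ℤ-Solver.solve-∀
  numerators : ℤ.+ (a ℕ.+ b) ℤ.* 1ℤ ≡ (ℤ.+ a ℤ.* 1ℤ ℤ.+ ℤ.+ b ℤ.* 1ℤ) ℤ.* 1ℤ
  numerators = trans (cong (ℤ._* 1ℤ) (ℤ.pos-+ a b)) (unit (ℤ.+ a) (ℤ.+ b))

*-≢0 : ∀ {p q} → p ≢ 0ℚ → q ≢ 0ℚ → p ℚ.* q ≢ 0ℚ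
*-≢0 {p} {q} p≢0 q≢0 pq≡0 = q≢0 (begin
  q                      ≡⟨ ℚ.*-identityˡ q ⟨
  1ℚ ℚ.* q               ≡⟨ cong (ℚ._* q) (ℚ.*-inverseˡ p) ⟨
  ℚ.1/ p ℚ.* p ℚ.* q     ≡⟨ ℚ.*-assoc (ℚ.1/ p) p q ⟩
  ℚ.1/ p ℚ.* (p ℚ.* q)   ≡⟨ cong (ℚ.1/ p ℚ.*_) pq≡0 ⟩
  ℚ.1/ p ℚ.* 0ℚ          ≡⟨ ℚ.*-zeroʳ (ℚ.1/ p) ⟩
  0ℚ                     ∎)
  where
  open ≡-Reasoning
  instance _ = ℚ.≢-nonZero p≢0

x+y+z≡3a⇒x≡a : ∀ {a x y z} → x ℚ.≤ a → y ℚ.≤ a → z ℚ.≤ a → x ℚ.+ y ℚ.+ z ≡ a ℚ.+ a ℚ.+ a → x ≡ a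
x+y+z≡3a⇒x≡a {a} {x} x≤a y≤a z≤a sum≡ with x ℚ.<? a
... | yes x<a = ⊥-elim (ℚ.<⇒≢ (ℚ.+-mono-<-≤ (ℚ.+-mono-<-≤ x<a y≤a) z≤a) sum≡)
... | no x≮a  = ℚ.≤-antisym x≤a (ℚ.≮⇒≥ x≮a)

norm : K → ℚ
norm (a ⊕ b √3) = a ℚ.* a ℚ.- three ℚ.* b ℚ.* b

module _ where
  open +-*-Solver

  norm-* : ∀ x y → norm (x *K y) ≡ norm x ℚ.* norm y
  norm-* (a ⊕ b √3) (c ⊕ d √3) = solve 5 (λ t a b c d →
      (a :* c :+ t :* b :* d) :* (a :* c :+ t :* b :* d) :- t :* (a :* d :+ b :* c) :* (a :* d :+ b :* c)
    := (a :* a :- t :* b :* b) :* (c :* c :- t :* d :* d)) refl three a b c d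

  norm-ι : ∀ q → norm (ι q) ≡ q ℚ.* q
  norm-ι q = solve 2 (λ t q → q :* q :- t :* con 0ℚ :* con 0ℚ := q :* q) refl three q

  re-via-norms : ∀ y → re y ≡ 1ℚ ℚ.+ ℚ.½ ℚ.* (norm y ℚ.- 1ℚ) ℚ.- ℚ.½ ℚ.* norm (1K -K y)
  re-via-norms (a ⊕ b √3) = solve 3 (λ t a b →
      a := con 1ℚ :+ con ℚ.½ :* (a :* a :- t :* b :* b :- con 1ℚ)
           :- con ℚ.½ :* ((con 1ℚ :+ (:- a)) :* (con 1ℚ :+ (:- a)) :- t :* (con 0ℚ :+ (:- b)) :* (con 0ℚ :+ (:- b))))
    refl three a b

  *K-invK : ∀ x → norm x ≢ 0ℚ → x *K invK x ≡ 1K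
  *K-invK (a ⊕ b √3) nx≢0 = ⊕-≡
    (trans (solve 4 (λ t a b u → a :* (a :* u) :+ t :* b :* ((:- b) :* u) := (a :* a :- t :* b :* b) :* u)
                    refl three a b (invℚ nx))
           (*-invℚ nx≢0))
    (solve 3 (λ a b u → a :* ((:- b) :* u) :+ b :* (a :* u) := con 0ℚ) refl a b (invℚ nx))
    where
    nx = a ℚ.* a ℚ.- three ℚ.* b ℚ.* b
    *-invℚ : ∀ {q} → q ≢ 0ℚ → q ℚ.* invℚ q ≡ 1ℚ
    *-invℚ {q} q≢0 with q ℚ.≟ 0ℚ
    ... | yes q≡0 = ⊥-elim (q≢0 q≡0)
    ... | no q≢0′ = ℚ.*-inverseʳ q {{ℚ.≢-nonZero q≢0′}}

  re-g* : ∀ a b → re (g *K (a ⊕ b √3)) ≡ a ℚ.+ (a ℚ.+ three ℚ.* (ℚ.- b))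
  re-g* a b = solve 3 (λ t a b → con (re g) :* a :+ t :* con (im g) :* b := a :+ (a :+ t :* (:- b)))
                      refl three a b

  im-g* : ∀ a b → im (g *K (a ⊕ b √3)) ≡ b ℚ.+ b ℚ.+ (ℚ.- a)
  im-g* a b = solve 2 (λ a b → con (re g) :* b :+ con (im g) :* a := b :+ b :+ (:- a)) refl a b

*K-invK-fromℕ : ∀ n → fromℕK (suc n) *K invK (fromℕK (suc n)) ≡ 1K
*K-invK-fromℕ n = *K-invK (fromℕK (suc n)) (λ eq → *-≢0 q≢0 q≢0 (trans (sym (norm-ι q)) eq))
  where
  q = ℤ.+ suc n ℚ./ 1
  q≢0 : q ≢ 0ℚ
  q≢0 = ≢-sym (ℚ.<⇒≢ (ℚ.positive⁻¹ q {{ℚ.normalize-pos (suc n) 1}}))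

norm-g^ : ∀ k → norm (g ^K k) ≡ 1ℚ
norm-g^ zero    = refl
norm-g^ (suc k) = trans (norm-* g (g ^K k)) (cong (norm g ℚ.*_) (norm-g^ k))

g*-bounds : ∀ x → 1ℚ ℚ.≤ re x → im x ℚ.≤ 0ℚ → 1ℚ ℚ.< re (g *K x) × im (g *K x) ℚ.≤ 0ℚ
g*-bounds (a ⊕ b √3) 1≤a b≤0 = re-bound , im-bound
  where
  0≤a : 0ℚ ℚ.≤ a
  0≤a = ℚ.≤-trans (ℚ.<⇒≤ (ℚ.positive⁻¹ 1ℚ)) 1≤a
  re-bound = begin-strict
    1ℚ                                 <⟨ ℚ.+-mono-≤-< (ℚ.≤-refl {1ℚ}) (ℚ.positive⁻¹ 1ℚ) ⟩
    1ℚ ℚ.+ (1ℚ ℚ.+ three ℚ.* 0ℚ)       ≤⟨ ℚ.+-mono-≤ 1≤a (ℚ.+-mono-≤ 1≤a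
                                            (ℚ.*-monoˡ-≤-nonNeg three {{_}} (ℚ.neg-antimono-≤ b≤0))) ⟩
    a ℚ.+ (a ℚ.+ three ℚ.* (ℚ.- b))    ≡⟨ re-g* a b ⟨
    re (g *K (a ⊕ b √3))               ∎
    where open ℚ.≤-Reasoning
  im-bound = begin
    im (g *K (a ⊕ b √3))   ≡⟨ im-g* a b ⟩
    b ℚ.+ b ℚ.+ (ℚ.- a)    ≤⟨ ℚ.+-mono-≤ (ℚ.+-mono-≤ b≤0 b≤0) (ℚ.neg-antimono-≤ 0≤a) ⟩
    0ℚ                     ∎
    where open ℚ.≤-Reasoning

g^-bounds : ∀ k → 1ℚ ℚ.≤ re (g ^K k) × im (g ^K k) ℚ.≤ 0ℚ
g^-bounds zero    = ℚ.≤-refl , ℚ.≤-refl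
g^-bounds (suc k) = ℚ.<⇒≤ (proj₁ (g*-bounds (g ^K k) 1≤re im≤0)) , proj₂ (g*-bounds (g ^K k) 1≤re im≤0)
  where
  1≤re = proj₁ (g^-bounds k)
  im≤0 = proj₂ (g^-bounds k)

1<re-g^suc : ∀ k → 1ℚ ℚ.< re (g ^K suc k)
1<re-g^suc k = proj₁ (g*-bounds (g ^K k) (proj₁ (g^-bounds k)) (proj₂ (g^-bounds k)))

norm[1-g^suc]≢0 : ∀ k → norm (1K -K g ^K suc k) ≢ 0ℚ
norm[1-g^suc]≢0 k n≡0 = ℚ.<⇒≢ (1<re-g^suc k) (sym (begin
  re y                                                          ≡⟨ re-via-norms y ⟩
  1ℚ ℚ.+ ℚ.½ ℚ.* (norm y ℚ.- 1ℚ) ℚ.- ℚ.½ ℚ.* norm (1K -K y)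
    ≡⟨ cong₂ (λ a b → 1ℚ ℚ.+ ℚ.½ ℚ.* (a ℚ.- 1ℚ) ℚ.- ℚ.½ ℚ.* b) (norm-g^ (suc k)) n≡0 ⟩
  1ℚ                                                            ∎))
  where
  open ≡-Reasoning
  y = g ^K suc k

denominator : ℕ → K
denominator n = fromℕK 2 *K √3 *K (1K -K g ^K n)

*K-invK-denominator : ∀ k → denominator (suc k) *K invK (denominator (suc k)) ≡ 1K
*K-invK-denominator k = *K-invK (denominator (suc k)) λ eq →
  *-≢0 {norm (fromℕK 2 *K √3)} (λ ()) (norm[1-g^suc]≢0 k)
    (trans (sym (norm-* (fromℕK 2 *K √3) (1K -K g ^K suc k))) eq)

[m%n+k]%n≡[m+k]%n : ∀ a b n .{{_ : NonZero n}} → (a % n + b) % n ≡ (a + b) % n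
[m%n+k]%n≡[m+k]%n a b n = begin
  (a % n + b) % n            ≡⟨ %-distribˡ-+ (a % n) b n ⟩
  (a % n % n + b % n) % n    ≡⟨ cong (λ x → (x + b % n) % n) (m%n%n≡m%n a n) ⟩
  (a % n + b % n) % n        ≡⟨ %-distribˡ-+ a b n ⟨
  (a + b) % n                ∎
  where open ≡-Reasoning

%-cancelʳ : ∀ {x y d n} .{{_ : NonZero n}} → x < n → y < n → d ≤ n →
            (x + d) % n ≡ (y + d) % n → x ≡ y
%-cancelʳ {x} {y} {d} {n} x<n y<n d≤n eq = begin
  x                          ≡⟨ reduce x<n ⟨
  (x + d + (n ∸ d)) % n      ≡⟨ [m%n+k]%n≡[m+k]%n (x + d) (n ∸ d) n ⟨
  ((x + d) % n + (n ∸ d)) % n ≡⟨ cong (λ z → (z + (n ∸ d)) % n) eq ⟩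
  ((y + d) % n + (n ∸ d)) % n ≡⟨ [m%n+k]%n≡[m+k]%n (y + d) (n ∸ d) n ⟩
  (y + d + (n ∸ d)) % n      ≡⟨ reduce y<n ⟩
  y                          ∎
  where
  open ≡-Reasoning
  reduce : ∀ {z} → z < n → (z + d + (n ∸ d)) % n ≡ z
  reduce {z} z<n = begin
    (z + d + (n ∸ d)) % n    ≡⟨ cong (_% n) (trans (ℕ.+-assoc z d (n ∸ d)) (cong (z +_) (ℕ.m+[n∸m]≡n d≤n))) ⟩
    (z + n) % n              ≡⟨ [m+n]%n≡m%n z n ⟩
    z % n                    ≡⟨ m<n⇒m%n≡m z<n ⟩
    z                        ∎

n∸k≡1+[n∸1+k] : ∀ {k n} → k < n → n ∸ k ≡ suc (n ∸ suc k)
n∸k≡1+[n∸1+k] {zero}  {suc n} _         = refl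
n∸k≡1+[n∸1+k] {suc k} {suc n} (ℕ.s≤s k<n) = n∸k≡1+[n∸1+k] k<n

same-or-other : ∀ s t → s ≡ t ⊎ s ≡ other t
same-or-other P P = inj₁ refl
same-or-other P Q = inj₂ refl
same-or-other Q P = inj₂ refl
same-or-other Q Q = inj₁ refl

δ-self : ∀ {m} (x : Vertex m) → δ x x ≡ 1K
δ-self x with x ≟V x
... | yes _   = refl
... | no x≢x = ⊥-elim (x≢x refl)

δ-≢ : ∀ {m} {x w : Vertex m} → x ≢ w → δ x w ≡ 0K
δ-≢ {x = x} {w} x≢w with x ≟V w
... | yes x≡w = ⊥-elim (x≢w x≡w)
... | no _    = refl

sideSign : Side → Side → K
sideSign P P = 1K
sideSign Q Q = 1K
sideSign P Q = -K 1K
sideSign Q P = -K 1K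

sideSign-other : ∀ s t → sideSign s (other t) ≡ -K sideSign s t
sideSign-other P P = refl
sideSign-other P Q = refl
sideSign-other Q P = refl
sideSign-other Q Q = refl

sideSign-comm : ∀ s t → sideSign s t ≡ sideSign t s
sideSign-comm P P = refl
sideSign-comm P Q = refl
sideSign-comm Q P = refl
sideSign-comm Q Q = refl

sideSign-self : ∀ s → sideSign s s ≡ 1K
sideSign-self P = refl
sideSign-self Q = refl

atZero : ℕ → K
atZero zero    = 1K
atZero (suc _) = 0K

module Prism (m : ℕ) where

  open ≡-Reasoning

  N : ℕ
  N = suc m

  infix 7 _⊖_

  _⊖_ : Fin N → Fin N → ℕ
  l ⊖ j = (toℕ l + (N ∸ toℕ j)) % N

  ⊖<N : ∀ l j → l ⊖ j < N
  ⊖<N l j = m%n<n (toℕ l + (N ∸ toℕ j)) N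

  toℕ+complement : ∀ (j : Fin N) → toℕ j + (N ∸ toℕ j) ≡ N
  toℕ+complement j = ℕ.m+[n∸m]≡n (Fin.toℕ≤n j)

  [toℕ+N]%N : ∀ (l : Fin N) → (toℕ l + N) % N ≡ toℕ l
  [toℕ+N]%N l = trans ([m+n]%n≡m%n (toℕ l) N) (m<n⇒m%n≡m (Fin.toℕ<n l))

  [mod+k]%N : ∀ a b → (toℕ (a mod N) + b) % N ≡ (a + b) % N
  [mod+k]%N a b = trans (cong (λ x → (x + b) % N) (Fin.toℕ-fromℕ< (m%n<n a N)))
                        ([m%n+k]%n≡[m+k]%n a b N)

  ⊖-self : ∀ j → j ⊖ j ≡ 0
  ⊖-self j = trans (cong (_% N) (toℕ+complement j)) (n%n≡0 N)

  shiftF-⊖ : ∀ j i → shiftF j i ⊖ j ≡ toℕ i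
  shiftF-⊖ j i = begin
    (toℕ (shiftF j i) + c) % N  ≡⟨ [mod+k]%N (toℕ j + toℕ i) c ⟩
    (toℕ j + toℕ i + c) % N     ≡⟨ cong (_% N) (swap (toℕ j) (toℕ i) c) ⟩
    (toℕ i + (toℕ j + c)) % N   ≡⟨ cong (λ x → (toℕ i + x) % N) (toℕ+complement j) ⟩
    (toℕ i + N) % N             ≡⟨ [toℕ+N]%N i ⟩
    toℕ i                       ∎
    where
    c = N ∸ toℕ j
    swap : ∀ a b c → a + b + c ≡ b + (a + c)
    swap = ℕ-Solver.solve-∀

  nextF-⊖ : ∀ l j → nextF l ⊖ j ≡ suc (l ⊖ j) % N
  nextF-⊖ l j = begin
    (toℕ (nextF l) + c) % N     ≡⟨ [mod+k]%N (suc (toℕ l)) c ⟩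
    suc (toℕ l + c) % N         ≡⟨ cong (_% N) (ℕ.+-comm 1 (toℕ l + c)) ⟩
    (toℕ l + c + 1) % N         ≡⟨ [m%n+k]%n≡[m+k]%n (toℕ l + c) 1 N ⟨
    (l ⊖ j + 1) % N             ≡⟨ cong (_% N) (ℕ.+-comm (l ⊖ j) 1) ⟩
    suc (l ⊖ j) % N             ∎
    where c = N ∸ toℕ j

  cyclicPred : ℕ → ℕ
  cyclicPred zero    = m
  cyclicPred (suc d) = d

  prevF-⊖ : ∀ l j → prevF l ⊖ j ≡ cyclicPred (l ⊖ j)
  prevF-⊖ l j = begin
    (toℕ (prevF l) + c) % N     ≡⟨ [mod+k]%N (toℕ l + m) c ⟩
    (toℕ l + m + c) % N         ≡⟨ cong (_% N) (swap (toℕ l) m c) ⟩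
    (toℕ l + c + m) % N         ≡⟨ [m%n+k]%n≡[m+k]%n (toℕ l + c) m N ⟨
    (l ⊖ j + m) % N             ≡⟨ [d+m]%N (l ⊖ j) (⊖<N l j) ⟩
    cyclicPred (l ⊖ j)               ∎
    where
    c = N ∸ toℕ j
    swap : ∀ a b c → a + b + c ≡ a + c + b
    swap = ℕ-Solver.solve-∀
    [d+m]%N : ∀ d → d < N → (d + m) % N ≡ cyclicPred d
    [d+m]%N zero    _   = m<n⇒m%n≡m (ℕ.n<1+n m)
    [d+m]%N (suc d) d<N = begin
      (suc d + m) % N   ≡⟨ cong (_% N) (ℕ.+-suc d m) ⟨
      (d + N) % N       ≡⟨ [m+n]%n≡m%n d N ⟩
      d % N             ≡⟨ m<n⇒m%n≡m (ℕ.<-trans (ℕ.n<1+n d) d<N) ⟩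
      d                 ∎

  ⊖≡0⇒≡ : ∀ l j → l ⊖ j ≡ 0 → l ≡ j
  ⊖≡0⇒≡ l j l⊖j≡0 = Fin.toℕ-injective (%-cancelʳ (Fin.toℕ<n l) (Fin.toℕ<n j) (ℕ.m∸n≤m N (toℕ j))
    (trans l⊖j≡0 (sym (⊖-self j))))

  ⊖+⊖ : ∀ j k → (j ⊖ k + k ⊖ j) % N ≡ 0
  ⊖+⊖ j k = begin
    (j ⊖ k + k ⊖ j) % N                   ≡⟨ %-distribˡ-+ (toℕ j + ck) (toℕ k + cj) N ⟨
    (toℕ j + ck + (toℕ k + cj)) % N       ≡⟨ cong (_% N) (regroup (toℕ j) ck (toℕ k) cj) ⟩
    ((toℕ j + cj) + (toℕ k + ck)) % N     ≡⟨ cong₂ (λ a b → (a + b) % N) (toℕ+complement j) (toℕ+complement k) ⟩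
    (N + N) % N                           ≡⟨ [m+n]%n≡m%n N N ⟩
    N % N                                 ≡⟨ n%n≡0 N ⟩
    0                                     ∎
    where
    cj = N ∸ toℕ j
    ck = N ∸ toℕ k
    regroup : ∀ a b c d → a + b + (c + d) ≡ (a + d) + (c + b)
    regroup = ℕ-Solver.solve-∀

  nextF-prevF : ∀ l → nextF (prevF l) ≡ l
  nextF-prevF l = Fin.toℕ-injective (begin
    toℕ (nextF (prevF l))       ≡⟨ Fin.toℕ-fromℕ< (m%n<n (suc (toℕ (prevF l))) N) ⟩
    (1 + toℕ (prevF l)) % N     ≡⟨ cong (λ x → (1 + x) % N) (Fin.toℕ-fromℕ< (m%n<n (toℕ l + m) N)) ⟩
    (1 + (toℕ l + m) % N) % N   ≡⟨ cong (_% N) (ℕ.+-comm 1 ((toℕ l + m) % N)) ⟩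
    ((toℕ l + m) % N + 1) % N   ≡⟨ [m%n+k]%n≡[m+k]%n (toℕ l + m) 1 N ⟩
    (toℕ l + m + 1) % N         ≡⟨ cong (_% N) (trans (ℕ.+-assoc (toℕ l) m 1) (cong (toℕ l +_) (ℕ.+-comm m 1))) ⟩
    (toℕ l + N) % N             ≡⟨ [toℕ+N]%N l ⟩
    toℕ l                       ∎)

  Palindromic : ∀ {a} {A : Set a} → (ℕ → A) → Set a
  Palindromic F = ∀ d → d ≤ N → F (N ∸ d) ≡ F d

  module _ {a} {A : Set a} {F : ℕ → A} (palindromic : Palindromic F) where

    palindromic-N : F N ≡ F 0
    palindromic-N = palindromic 0 ℕ.z≤n

    palindromic-suc : ∀ d → d < N → F (suc d % N) ≡ F (suc d)
    palindromic-suc d d<N with ℕ.m≤n⇒m<n∨m≡n d<N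
    ... | inj₁ 1+d<N  = cong F (m<n⇒m%n≡m 1+d<N)
    ... | inj₂ refl   = trans (cong F (n%n≡0 N)) (sym palindromic-N)

    palindromic-⊖ : ∀ j k → F (j ⊖ k) ≡ F (k ⊖ j)
    palindromic-⊖ j k = opposite (⊖<N j k) (⊖<N k j) (⊖+⊖ j k)
      where
      opposite : ∀ {x y} → x < N → y < N → (x + y) % N ≡ 0 → F x ≡ F y
      opposite {x} {zero} x<N _ x+0≡0 =
        cong F (trans (sym (m<n⇒m%n≡m x<N)) (trans (cong (_% N) (sym (ℕ.+-identityʳ x))) x+0≡0))
      opposite {x} {y@(suc _)} x<N y<N x+y≡0 = trans (cong F x≡N-y) (palindromic y (ℕ.<⇒≤ y<N))
        where
        x≡N-y : x ≡ N ∸ y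
        x≡N-y = %-cancelʳ x<N (ℕ.∸-monoʳ-< ℕ.z<s (ℕ.<⇒≤ y<N)) (ℕ.<⇒≤ y<N)
          (trans x+y≡0 (sym (trans (cong (_% N) (ℕ.m∸n+n≡m (ℕ.<⇒≤ y<N))) (n%n≡0 N))))

  shiftF-zero : ∀ i → shiftF zero i ≡ i
  shiftF-zero i = Fin.toℕ-injective (trans (Fin.toℕ-fromℕ< (m%n<n (toℕ i) N)) (m<n⇒m%n≡m (Fin.toℕ<n i)))

  -- The maximum principle

  Laplacianℚ : (Vertex m → ℚ) → Vertex m → ℚ
  Laplacianℚ f (s , j) =
      (f (s , j) ℚ.- f (s , nextF j))
    ℚ.+ (f (s , j) ℚ.- f (s , prevF j))
    ℚ.+ (f (s , j) ℚ.- f (other s , j))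

  vertices : List (Vertex m)
  vertices = cartesianProduct (P ∷ Q ∷ []) (allFin N)

  ∈-vertices : ∀ w → w ∈ vertices
  ∈-vertices (P , j) = ∈-cartesianProduct⁺ {xs = P ∷ Q ∷ []} (here refl) (∈-allFin j)
  ∈-vertices (Q , j) = ∈-cartesianProduct⁺ {xs = P ∷ Q ∷ []} (there (here refl)) (∈-allFin j)

  module Maximum (f : Vertex m → ℚ) (harmonic : ∀ w → Laplacianℚ f w ≡ 0ℚ)
                 (s* : Side) (j* : Fin N) (maximal : ∀ w → f w ℚ.≤ f (s* , j*)) where

    M : ℚ
    M = f (s* , j*)

    neighbours-maximal : ∀ s j → f (s , j) ≡ M →
      f (s , nextF j) ≡ M × f (s , prevF j) ≡ M × f (other s , j) ≡ M
    neighbours-maximal s j fsj≡M =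
        x+y+z≡3a⇒x≡a (maximal _) (maximal _) (maximal _) sum≡
      , x+y+z≡3a⇒x≡a (maximal _) (maximal _) (maximal _) (trans (rotate y x z) sum≡)
      , x+y+z≡3a⇒x≡a (maximal _) (maximal _) (maximal _) (trans (cycle x y z) sum≡)
      where
      open +-*-Solver
      x = f (s , nextF j)
      y = f (s , prevF j)
      z = f (other s , j)
      rotate : ∀ a b c → a ℚ.+ b ℚ.+ c ≡ b ℚ.+ a ℚ.+ c
      rotate = solve 3 (λ a b c → a :+ b :+ c := b :+ a :+ c) refl
      cycle : ∀ a b c → c ℚ.+ a ℚ.+ b ≡ a ℚ.+ b ℚ.+ c
      cycle = solve 3 (λ a b c → c :+ a :+ b := a :+ b :+ c) refl
      balance : ∀ v a b c → a ℚ.+ b ℚ.+ c ≡ v ℚ.+ v ℚ.+ v ℚ.- ((v ℚ.- a) ℚ.+ (v ℚ.- b) ℚ.+ (v ℚ.- c))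
      balance = solve 4 (λ v a b c → a :+ b :+ c := v :+ v :+ v :- ((v :- a) :+ (v :- b) :+ (v :- c))) refl
      sum≡ : x ℚ.+ y ℚ.+ z ≡ M ℚ.+ M ℚ.+ M
      sum≡ = begin
        x ℚ.+ y ℚ.+ z                                ≡⟨ balance v x y z ⟩
        v ℚ.+ v ℚ.+ v ℚ.- Laplacianℚ f (s , j)       ≡⟨ cong (λ l → v ℚ.+ v ℚ.+ v ℚ.- l) (harmonic (s , j)) ⟩
        v ℚ.+ v ℚ.+ v ℚ.- 0ℚ                         ≡⟨ ℚ.+-identityʳ (v ℚ.+ v ℚ.+ v) ⟩
        v ℚ.+ v ℚ.+ v                                ≡⟨ cong (λ l → l ℚ.+ l ℚ.+ l) fsj≡M ⟩
        M ℚ.+ M ℚ.+ M                                ∎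
        where
        v = f (s , j)

    maximal-on-side : ∀ k l → l ⊖ j* ≡ k → f (s* , l) ≡ M
    maximal-on-side zero    l l⊖j*≡0 = cong (λ i → f (s* , i)) (⊖≡0⇒≡ l j* l⊖j*≡0)
    maximal-on-side (suc k) l l⊖j*≡k+1 =
      subst (λ i → f (s* , i) ≡ M) (nextF-prevF l)
        (proj₁ (neighbours-maximal s* (prevF l)
          (maximal-on-side k (prevF l) (trans (prevF-⊖ l j*) (cong cyclicPred l⊖j*≡k+1)))))

    maximal-everywhere : ∀ w → f w ≡ M
    maximal-everywhere (s , l) with same-or-other s s*
    ... | inj₁ refl = maximal-on-side (l ⊖ j*) l refl
    ... | inj₂ refl = proj₂ (proj₂ (neighbours-maximal s* l (maximal-on-side (l ⊖ j*) l refl)))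

  harmonic⇒constant : ∀ f → (∀ w → Laplacianℚ f w ≡ 0ℚ) → ∀ x y → f x ≡ f y
  harmonic⇒constant f harmonic x y = trans (maximal-everywhere x) (sym (maximal-everywhere y))
    where
    module Max = Extrema (DecTotalOrder.totalOrder ℚ.≤-decTotalOrder)
    w* = Max.argmax f (P , zero) vertices
    maximal : ∀ w → f w ℚ.≤ f w*
    maximal w = All.lookup (Max.f[xs]≤f[argmax] {f = f} (P , zero) vertices) (∈-vertices w)
    open Maximum f harmonic (proj₁ w*) (proj₂ w*) maximal

  -- The Green kernel

  D : K
  D = denominator N

  c : K
  c = fromℕK 2 /K fromℕK (2 ℕ.* N)

  quad : ℕ → K
  quad = quadPart N

  expo : ℕ → K
  expo d = (g ^K d +K g ^K (N ∸ d)) /K D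

  quad-palindromic : Palindromic quad
  quad-palindromic d d≤N = cong (λ n → fromℕK n /K fromℕK (2 ℕ.* N))
    (trans (cong (ℕ._* (N ∸ d)) (ℕ.m∸[m∸n]≡n d≤N)) (ℕ.*-comm d (N ∸ d)))

  expo-palindromic : Palindromic expo
  expo-palindromic d d≤N = cong (_/K D)
    (trans (cong (λ n → g ^K (N ∸ d) +K g ^K n) (ℕ.m∸[m∸n]≡n d≤N)) (+K-comm (g ^K (N ∸ d)) (g ^K d)))

  quad-zero : quad 0 ≡ 0K
  quad-zero = trans (cong (λ n → fromℕK n /K fromℕK (2 ℕ.* N)) (ℕ.*-zeroʳ N))
                    (zero-* (invK (fromℕK (2 ℕ.* N))))
    where
    zero-* : ∀ x → 0K *K x ≡ 0K
    zero-* = solve-∀ K-almostCommutativeRing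

  N∸d≡2+[N∸[2+d]] : ∀ {d} → suc d < N → N ∸ d ≡ suc (suc (N ∸ suc (suc d)))
  N∸d≡2+[N∸[2+d]] {d} 1+d<N =
    trans (n∸k≡1+[n∸1+k] (ℕ.<-trans (ℕ.n<1+n d) 1+d<N)) (cong suc (n∸k≡1+[n∸1+k] 1+d<N))

  Δ : (ℕ → K) → ℕ → K
  Δ F d = F d +K F d -K F (suc d) -K F (cyclicPred d)

  Δ-quad : ∀ d → d < N → Δ quad d ≡ c -K atZero d
  Δ-quad zero _ = begin
    Δ quad 0
      ≡⟨ cong₂ (λ a b → fromℕK a *K I +K fromℕK a *K I -K fromℕK (m ℕ.* 1) *K I -K fromℕK (b ℕ.* m) *K I)
               (ℕ.*-zeroʳ N) (ℕ.m+n∸n≡m 1 m) ⟩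
    0K *K I +K 0K *K I -K fromℕK (m ℕ.* 1) *K I -K fromℕK (1 ℕ.* m) *K I
      ≡⟨ cong₂ (λ a b → 0K *K I +K 0K *K I -K fromℕK a *K I -K fromℕK b *K I)
               (ℕ.*-identityʳ m) (ℕ.*-identityˡ m) ⟩
    0K *K I +K 0K *K I -K M *K I -K M *K I
      ≡⟨ rearrange (fromℕK 2) M I ⟩
    fromℕK 2 *K I -K (fromℕK 2 +K M +K M) *K I
      ≡⟨ cong (λ x → c -K x *K I) fromℕK[2N] ⟨
    c -K fromℕK (2 ℕ.* N) *K I
      ≡⟨ cong (λ x → c -K x) (*K-invK-fromℕ (m ℕ.+ 1 ℕ.* N)) ⟩
    c -K 1K
      ∎
    where
    I = invK (fromℕK (2 ℕ.* N))
    M = fromℕK m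
    twice : ∀ m → 2 ℕ.* suc m ≡ 2 ℕ.+ m ℕ.+ m
    twice = ℕ-Solver.solve-∀
    fromℕK[2N] : fromℕK (2 ℕ.* N) ≡ fromℕK 2 +K M +K M
    fromℕK[2N] = trans (cong fromℕK (twice m)) (trans (fromℕK-+ (2 ℕ.+ m) m) (cong (_+K M) (fromℕK-+ 2 m)))
    rearrange : ∀ t x i → 0K *K i +K 0K *K i -K x *K i -K x *K i ≡ t *K i -K (t +K x +K x) *K i
    rearrange = solve-∀ K-almostCommutativeRing
  Δ-quad (suc d) 1+d<N = begin
    Δ quad (suc d)
      ≡⟨ cong₂ (λ a b → fromℕK (a ℕ.* suc d) *K I +K fromℕK (a ℕ.* suc d) *K I
                        -K fromℕK (e ℕ.* suc (suc d)) *K I -K fromℕK (b ℕ.* d) *K I)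
               (n∸k≡1+[n∸1+k] 1+d<N) (N∸d≡2+[N∸[2+d]] 1+d<N) ⟩
    X *K I +K X *K I -K Y *K I -K Z *K I
      ≡⟨ rearrange X Y Z I ⟩
    (X +K X -K Y -K Z) *K I
      ≡⟨ cong (λ x → (x -K Y -K Z) *K I) X+X ⟩
    (Y +K Z +K fromℕK 2 -K Y -K Z) *K I
      ≡⟨ cancel Y Z (fromℕK 2) I ⟩
    c -K 0K
      ∎
    where
    I = invK (fromℕK (2 ℕ.* N))
    e = N ∸ suc (suc d)
    X = fromℕK (suc e ℕ.* suc d)
    Y = fromℕK (e ℕ.* suc (suc d))
    Z = fromℕK (suc (suc e) ℕ.* d)
    second-difference : ∀ e d → (1 ℕ.+ e) ℕ.* (1 ℕ.+ d) ℕ.+ (1 ℕ.+ e) ℕ.* (1 ℕ.+ d)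
                              ≡ e ℕ.* (2 ℕ.+ d) ℕ.+ (2 ℕ.+ e) ℕ.* d ℕ.+ 2
    second-difference = ℕ-Solver.solve-∀
    X+X : X +K X ≡ Y +K Z +K fromℕK 2
    X+X = begin
      X +K X                                         ≡⟨ fromℕK-+ (suc e ℕ.* suc d) (suc e ℕ.* suc d) ⟨
      fromℕK (suc e ℕ.* suc d ℕ.+ suc e ℕ.* suc d)   ≡⟨ cong fromℕK (second-difference e d) ⟩
      fromℕK (e ℕ.* suc (suc d) ℕ.+ suc (suc e) ℕ.* d ℕ.+ 2)
        ≡⟨ fromℕK-+ (e ℕ.* suc (suc d) ℕ.+ suc (suc e) ℕ.* d) 2 ⟩
      fromℕK (e ℕ.* suc (suc d) ℕ.+ suc (suc e) ℕ.* d) +K fromℕK 2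
        ≡⟨ cong (_+K fromℕK 2) (fromℕK-+ (e ℕ.* suc (suc d)) (suc (suc e) ℕ.* d)) ⟩
      Y +K Z +K fromℕK 2                             ∎
    rearrange : ∀ x y z i → x *K i +K x *K i -K y *K i -K z *K i ≡ (x +K x -K y -K z) *K i
    rearrange = solve-∀ K-almostCommutativeRing
    cancel : ∀ y z t i → (y +K z +K t -K y -K z) *K i ≡ t *K i -K 0K
    cancel = solve-∀ K-almostCommutativeRing

  -- g and √3 are closed constants, so the solver evaluates their coefficients: this is
  -- where g² = 4g − 1 (interior) and 4 − 2g = 2√3 = (4g − 2) / (−g) (boundary) are used.
  Δ-expo : ∀ d → d < N → Δ expo d +K expo d +K expo d ≡ atZero d
  Δ-expo zero _ = begin
    Δ expo 0 +K expo 0 +K expo 0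
      ≡⟨ cong (λ a → E 0 N +K E 0 N -K E 1 m -K E m a +K E 0 N +K E 0 N) (ℕ.m+n∸n≡m 1 m) ⟩
    E 0 N +K E 0 N -K E 1 m -K E m 1 +K E 0 N +K E 0 N
      ≡⟨ boundary (g ^K m) (invK D) ⟩
    D *K invK D
      ≡⟨ *K-invK-denominator m ⟩
    1K
      ∎
    where
    E : ℕ → ℕ → K
    E a b = (g ^K a +K g ^K b) *K invK D
    boundary : ∀ x i → (1K +K g *K x) *K i +K (1K +K g *K x) *K i -K (g *K 1K +K x) *K i -K (x +K g *K 1K) *K i
                        +K (1K +K g *K x) *K i +K (1K +K g *K x) *K i
                      ≡ (fromℕK 2 *K √3 *K (1K -K g *K x)) *K i
    boundary = solve-∀ K-almostCommutativeRing
  Δ-expo (suc d) 1+d<N = begin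
    Δ expo (suc d) +K expo (suc d) +K expo (suc d)
      ≡⟨ cong₂ (λ a b → E (suc d) a +K E (suc d) a -K E (suc (suc d)) e -K E d b +K E (suc d) a +K E (suc d) a)
               (n∸k≡1+[n∸1+k] 1+d<N) (N∸d≡2+[N∸[2+d]] 1+d<N) ⟩
    E (suc d) (suc e) +K E (suc d) (suc e) -K E (suc (suc d)) e -K E d (suc (suc e))
      +K E (suc d) (suc e) +K E (suc d) (suc e)
      ≡⟨ interior (g ^K d) (g ^K e) (invK D) ⟩
    0K
      ∎
    where
    E : ℕ → ℕ → K
    E a b = (g ^K a +K g ^K b) *K invK D
    e = N ∸ suc (suc d)
    interior : ∀ x y i → (g *K x +K g *K y) *K i +K (g *K x +K g *K y) *K i -K (g *K (g *K x) +K y) *K i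
                         -K (x +K g *K (g *K y)) *K i +K (g *K x +K g *K y) *K i +K (g *K x +K g *K y) *K i
                       ≡ 0K
    interior = solve-∀ K-almostCommutativeRing

  radial : K → ℕ → K
  radial σ d = quad d -K σ *K expo d

  Λ : Vertex m → Vertex m → K
  Λ (s , j) (t , l) = radial (sideSign s t) (l ⊖ j)

  δ+δ : ∀ s j t l → δ {m} (s , j) (t , l) +K δ (s , j) (t , l) ≡ (1K +K sideSign s t) *K atZero (l ⊖ j)
  δ+δ s j t l with l ⊖ j in l⊖j≡d
  ... | suc d = trans (cong (λ x → x +K x) (δ-≢ {x = s , j} {t , l} λ { refl → l≢j refl })) (zero-sum (sideSign s t))
    where
    l≢j : l ≢ j
    l≢j refl = ℕ.0≢1+n (trans (sym (⊖-self j)) l⊖j≡d)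
    zero-sum : ∀ σ → 0K +K 0K ≡ (1K +K σ) *K 0K
    zero-sum = solve-∀ K-almostCommutativeRing
  ... | zero with ⊖≡0⇒≡ l j l⊖j≡d
  δ+δ P j P _ | zero | refl = cong (λ x → x +K x) (δ-self (P , j))
  δ+δ Q j Q _ | zero | refl = cong (λ x → x +K x) (δ-self (Q , j))
  δ+δ P j Q _ | zero | refl = cong (λ x → x +K x) (δ-≢ {x = P , j} {Q , j} λ ())
  δ+δ Q j P _ | zero | refl = cong (λ x → x +K x) (δ-≢ {x = Q , j} {P , j} λ ())

  Laplacian-Λ : ∀ x w → Laplacian (Λ x) w ≡ c -K (δ x w +K δ x w)
  Laplacian-Λ (s , j) (t , l) = begin
    Laplacian (Λ (s , j)) (t , l)
      ≡⟨ cong₂ (λ a b → L a b (Λ (s , j) (other t , l))) Λ-next Λ-prev ⟩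
    L (radial σ (suc d)) (radial σ (cyclicPred d)) (radial (sideSign s (other t)) d)
      ≡⟨ cong (λ τ → L (radial σ (suc d)) (radial σ (cyclicPred d)) (radial τ d)) (sideSign-other s t) ⟩
    L (radial σ (suc d)) (radial σ (cyclicPred d)) (radial (-K σ) d)
      ≡⟨ split σ (quad d) (quad (suc d)) (quad (cyclicPred d)) (expo d) (expo (suc d)) (expo (cyclicPred d)) ⟩
    Δ quad d -K σ *K (Δ expo d +K expo d +K expo d)
      ≡⟨ cong₂ (λ a b → a -K σ *K b) (Δ-quad d (⊖<N l j)) (Δ-expo d (⊖<N l j)) ⟩
    (c -K atZero d) -K σ *K atZero d
      ≡⟨ collect c σ (atZero d) ⟩
    c -K (1K +K σ) *K atZero d
      ≡⟨ cong (λ x → c -K x) (δ+δ s j t l) ⟨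
    c -K (δ (s , j) (t , l) +K δ (s , j) (t , l))
      ∎
    where
    d = l ⊖ j
    σ = sideSign s t
    L : K → K → K → K
    L a b e = (radial σ d -K a) +K (radial σ d -K b) +K (radial σ d -K e)
    Λ-next : Λ (s , j) (t , nextF l) ≡ radial σ (suc d)
    Λ-next = cong₂ (λ a b → a -K σ *K b)
      (trans (cong quad (nextF-⊖ l j)) (palindromic-suc quad-palindromic d (⊖<N l j)))
      (trans (cong expo (nextF-⊖ l j)) (palindromic-suc expo-palindromic d (⊖<N l j)))
    Λ-prev : Λ (s , j) (t , prevF l) ≡ radial σ (cyclicPred d)
    Λ-prev = cong (radial σ) (prevF-⊖ l j)
    split : ∀ σ q q⁺ q⁻ e e⁺ e⁻ →
        ((q -K σ *K e) -K (q⁺ -K σ *K e⁺)) +K ((q -K σ *K e) -K (q⁻ -K σ *K e⁻))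
          +K ((q -K σ *K e) -K (q -K (-K σ) *K e))
      ≡ (q +K q -K q⁺ -K q⁻) -K σ *K ((e +K e -K e⁺ -K e⁻) +K e +K e)
    split = solve-∀ K-almostCommutativeRing
    collect : ∀ c σ a → (c -K a) -K σ *K a ≡ c -K (1K +K σ) *K a
    collect = solve-∀ K-almostCommutativeRing

  Λ-comm : ∀ x y → Λ x y ≡ Λ y x
  Λ-comm (s , j) (t , k) = cong₂ _-K_ (palindromic-⊖ quad-palindromic k j)
    (cong₂ _*K_ (sideSign-comm s t) (palindromic-⊖ expo-palindromic k j))

  Λ-self : ∀ x → Λ x x ≡ radial 1K 0
  Λ-self (s , j) = cong₂ radial (sideSign-self s) (⊖-self j)

  -- Effective resistances

  Laplacian-scale : ∀ a (f : Vertex m → K) w → Laplacian (λ v → a *K f v) w ≡ a *K Laplacian f w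
  Laplacian-scale a f (s , j) = identity a (f (s , j)) (f (s , nextF j)) (f (s , prevF j)) (f (other s , j))
    where
    identity : ∀ a f₀ f₁ f₂ f₃ →
      (a *K f₀ -K a *K f₁) +K (a *K f₀ -K a *K f₂) +K (a *K f₀ -K a *K f₃)
        ≡ a *K ((f₀ -K f₁) +K (f₀ -K f₂) +K (f₀ -K f₃))
    identity = solve-∀ K-almostCommutativeRing

  Laplacian-difference : ∀ (f h : Vertex m → K) w →
    Laplacian (λ v → f v -K h v) w ≡ Laplacian f w -K Laplacian h w
  Laplacian-difference f h (s , j) =
    identity (f (s , j)) (f (s , nextF j)) (f (s , prevF j)) (f (other s , j))
             (h (s , j)) (h (s , nextF j)) (h (s , prevF j)) (h (other s , j))
    where
    identity : ∀ f₀ f₁ f₂ f₃ h₀ h₁ h₂ h₃ →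
        ((f₀ -K h₀) -K (f₁ -K h₁)) +K ((f₀ -K h₀) -K (f₂ -K h₂)) +K ((f₀ -K h₀) -K (f₃ -K h₃))
      ≡ ((f₀ -K f₁) +K (f₀ -K f₂) +K (f₀ -K f₃)) -K ((h₀ -K h₁) +K (h₀ -K h₂) +K (h₀ -K h₃))
    identity = solve-∀ K-almostCommutativeRing

  potential : Vertex m → Vertex m → Vertex m → K
  potential x y w = ι ℚ.½ *K (Λ y w -K Λ x w)

  potential-isPotential : ∀ x y → IsPotential x y (potential x y)
  potential-isPotential x y w = begin
    Laplacian (potential x y) w
      ≡⟨ Laplacian-scale (ι ℚ.½) (λ v → Λ y v -K Λ x v) w ⟩
    ι ℚ.½ *K Laplacian (λ v → Λ y v -K Λ x v) w
      ≡⟨ cong (ι ℚ.½ *K_) (Laplacian-difference (Λ y) (Λ x) w) ⟩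
    ι ℚ.½ *K (Laplacian (Λ y) w -K Laplacian (Λ x) w)
      ≡⟨ cong₂ (λ a b → ι ℚ.½ *K (a -K b)) (Laplacian-Λ y w) (Laplacian-Λ x w) ⟩
    ι ℚ.½ *K ((c -K (δ y w +K δ y w)) -K (c -K (δ x w +K δ x w)))
      ≡⟨ halve c (δ x w) (δ y w) ⟩
    δ x w -K δ y w
      ∎
    where
    halve : ∀ c a b → ι ℚ.½ *K ((c -K (b +K b)) -K (c -K (a +K a))) ≡ a -K b
    halve = solve-∀ K-almostCommutativeRing

  -- re and im commute definitionally with the Laplacian, so each of them is harmonic.
  potential-unique : ∀ x y v → IsPotential x y v → ∀ a b →
    v a -K potential x y a ≡ v b -K potential x y b
  potential-unique x y v v-isPotential a b =
    ⊕-≡ (harmonic⇒constant (λ w → re (u w)) (λ w → cong re (u-harmonic w)) a b)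
        (harmonic⇒constant (λ w → im (u w)) (λ w → cong im (u-harmonic w)) a b)
    where
    u : Vertex m → K
    u w = v w -K potential x y w
    u-harmonic : ∀ w → Laplacian u w ≡ 0K
    u-harmonic w = begin
      Laplacian u w                                ≡⟨ Laplacian-difference v (potential x y) w ⟩
      Laplacian v w -K Laplacian (potential x y) w ≡⟨ cong₂ _-K_ (v-isPotential w) (potential-isPotential x y w) ⟩
      (δ x w -K δ y w) -K (δ x w -K δ y w)         ≡⟨ -K-inverseʳ (δ x w -K δ y w) ⟩
      0K                                           ∎

  potential-drop : ∀ x y → potential x y x -K potential x y y ≡ Λ x y -K Λ x x
  potential-drop x y = begin
    ι ℚ.½ *K (Λ y x -K Λ x x) -K ι ℚ.½ *K (Λ y y -K Λ x y)
      ≡⟨ cong₂ (λ a b → ι ℚ.½ *K (a -K Λ x x) -K ι ℚ.½ *K (b -K Λ x y))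
               (Λ-comm y x) (trans (Λ-self y) (sym (Λ-self x))) ⟩
    ι ℚ.½ *K (Λ x y -K Λ x x) -K ι ℚ.½ *K (Λ x x -K Λ x y)
      ≡⟨ halves (Λ x y) (Λ x x) ⟩
    Λ x y -K Λ x x
      ∎
    where
    halves : ∀ a b → ι ℚ.½ *K (a -K b) -K ι ℚ.½ *K (b -K a) ≡ a -K b
    halves = solve-∀ K-almostCommutativeRing

  Λ-isEffRes : ∀ x y → IsEffRes x y (Λ x y -K Λ x x)
  Λ-isEffRes x y = p , potential-isPotential x y , λ v v-isPotential → begin
    v x -K v y
      ≡⟨ split (v x) (v y) (p x) (p y) ⟩
    (v x -K p x) -K (v y -K p y) +K (p x -K p y)
      ≡⟨ cong (λ a → a -K (v y -K p y) +K (p x -K p y)) (potential-unique x y v v-isPotential x y) ⟩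
    (v y -K p y) -K (v y -K p y) +K (p x -K p y)
      ≡⟨ cancel (v y -K p y) (p x -K p y) ⟩
    p x -K p y
      ≡⟨ potential-drop x y ⟩
    Λ x y -K Λ x x
      ∎
    where
    p = potential x y
    split : ∀ a b c d → a -K b ≡ (a -K c) -K (b -K d) +K (c -K d)
    split = solve-∀ K-almostCommutativeRing
    cancel : ∀ a b → a -K a +K b ≡ b
    cancel = solve-∀ K-almostCommutativeRing

  shifted-isEffRes : ∀ s t j i → IsEffRes (s , j) (t , shiftF j i) (radial (sideSign s t) (toℕ i) -K radial 1K 0)
  shifted-isEffRes s t j i = subst (IsEffRes (s , j) (t , shiftF j i))
    (cong₂ _-K_ (cong (radial (sideSign s t)) (shiftF-⊖ j i)) (Λ-self (s , j)))
    (Λ-isEffRes (s , j) (t , shiftF j i))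

  radial-rPP : ∀ i → radial 1K (toℕ i) -K radial 1K 0 ≡ rPP m i
  radial-rPP i = trans (cong (λ q → radial 1K (toℕ i) -K (q -K 1K *K expo 0)) quad-zero)
    (closed-form (quad (toℕ i)) (g ^K N) (g ^K (N ∸ toℕ i)) (g ^K toℕ i) (invK D))
    where
    closed-form : ∀ q x y z i → q -K 1K *K ((z +K y) *K i) -K (0K -K 1K *K ((1K +K x) *K i))
                              ≡ (1K +K x -K y -K z) *K i +K q
    closed-form = solve-∀ K-almostCommutativeRing

  radial-rPQ : ∀ i → radial (-K 1K) (toℕ i) -K radial 1K 0 ≡ rPQ m i
  radial-rPQ i = trans (cong (λ q → radial (-K 1K) (toℕ i) -K (q -K 1K *K expo 0)) quad-zero)
    (closed-form (quad (toℕ i)) (g ^K N) (g ^K (N ∸ toℕ i)) (g ^K toℕ i) (invK D))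
    where
    closed-form : ∀ q x y z i → q -K (-K 1K) *K ((z +K y) *K i) -K (0K -K 1K *K ((1K +K x) *K i))
                              ≡ (1K +K x +K y +K z) *K i +K q
    closed-form = solve-∀ K-almostCommutativeRing

  same-side : ∀ s j i → IsEffRes (s , j) (s , shiftF j i) (rPP m i)
  same-side s j i = subst (IsEffRes (s , j) (s , shiftF j i))
    (trans (cong (λ σ → radial σ (toℕ i) -K radial 1K 0) (sideSign-self s)) (radial-rPP i))
    (shifted-isEffRes s s j i)

  other-side : ∀ s j i → IsEffRes (s , j) (other s , shiftF j i) (rPQ m i)
  other-side s j i = subst (IsEffRes (s , j) (other s , shiftF j i))
    (trans (cong (λ σ → radial σ (toℕ i) -K radial 1K 0) sideSign-other-self) (radial-rPQ i))
    (shifted-isEffRes s (other s) j i)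
    where
    sideSign-other-self : sideSign s (other s) ≡ -K 1K
    sideSign-other-self = trans (sideSign-other s s) (cong (λ σ → -K σ) (sideSign-self s))

mainTheorem3 : (m : ℕ)
  → ((i : Fin (Data.Nat.suc m))
      → IsEffRes (P , zero) (P , i) (rPP m i)
      × IsEffRes (P , zero) (Q , i) (rPQ m i))
  × ((j i : Fin (Data.Nat.suc m))
      → IsEffRes (P , j) (P , shiftF j i) (rPP m i)
      × IsEffRes (Q , j) (Q , shiftF j i) (rPP m i)
      × IsEffRes (P , j) (Q , shiftF j i) (rPQ m i)
      × IsEffRes (Q , j) (P , shiftF j i) (rPQ m i))
mainTheorem3 m =
    (λ i → from-origin (same-side P zero i) , from-origin (other-side P zero i))
  , (λ j i → same-side P j i , same-side Q j i , other-side P j i , other-side Q j i)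
  where
  open Prism m
  from-origin : ∀ {t i r} → IsEffRes (P , zero) (t , shiftF zero i) r → IsEffRes (P , zero) (t , i) r
  from-origin {t} {i} {r} = subst (λ k → IsEffRes (P , zero) (t , k) r) (shiftF-zero i)
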